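{- In a dagger category $(\mathbb{X},\dagger)$, for any map $f: A\to B$ the following are equivalent: (i) $f$ is Moore-Penrose invertible; (ii) $f^\dagger f$ is Moore-Penrose invertible and $f(f^\dagger f)^\circ f^\dagger f = f$; (iii) $ff^\dagger$ is Moore-Penrose invertible and $ff^\dagger(ff^\dagger)^\circ f = f$. Consequently, $(\mathbb{X},\dagger)$ is Moore-Penrose if and only if every map $f$ satisfies (ii) or (iii).
   Context: Composition is in diagrammatic order ($fg$ is $f$ followed by $g$). A dagger category is a category with an identity-on-objects contravariant involutive functor $\dagger$. A Moore-Penrose inverse of $f: A\to B$ is $f^\circ: B\to A$ with $ff^\circ f = f$, $f^\circ f f^\circ = f^\circ$, $(ff^\circ)^\dagger = ff^\circ$, $(f^\circ f)^\dagger = f^\circ f$ (it is unique when it exists); $f$ is Moore-Penrose invertible if one exists. A dagger category is Moore-Penrose if every map is Moore-Penrose invertible. -}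

module Defs where

open import Level using (Level; suc; _⊔_)
open import Relation.Binary using (IsEquivalence)
open import Data.Product using (Σ; _×_; ∃)
open import Data.Sum using (_⊎_)
open import Function.Bundles using (_⇔_)

-- A category with a setoid of morphisms; composition in diagrammatic order:
-- f ⨾ g is f followed by g.
record DaggerCategory (o m e : Level) : Set (suc (o ⊔ m ⊔ e)) where
  infixr 9 _⨾_
  infix  4 _≈_
  field
    Obj   : Set o
    Hom   : Obj → Obj → Set m
    _≈_   : ∀ {A B} → Hom A B → Hom A B → Set e
    ≈-equiv : ∀ {A B} → IsEquivalence (_≈_ {A} {B})
    id    : ∀ {A} → Hom A A
    _⨾_   : ∀ {A B C} → Hom A B → Hom B C → Hom A C
    ⨾-resp-≈ : ∀ {A B C} {f f′ : Hom A B} {g g′ : Hom B C} →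
               f ≈ f′ → g ≈ g′ → (f ⨾ g) ≈ (f′ ⨾ g′)
    assoc : ∀ {A B C D} (f : Hom A B) (g : Hom B C) (h : Hom C D) →
            ((f ⨾ g) ⨾ h) ≈ (f ⨾ (g ⨾ h))
    idˡ   : ∀ {A B} (f : Hom A B) → (id ⨾ f) ≈ f
    idʳ   : ∀ {A B} (f : Hom A B) → (f ⨾ id) ≈ f
    _†    : ∀ {A B} → Hom A B → Hom B A
    †-resp-≈ : ∀ {A B} {f g : Hom A B} → f ≈ g → (f †) ≈ (g †)
    †-id  : ∀ {A} → ((id {A}) †) ≈ id
    †-⨾   : ∀ {A B C} (f : Hom A B) (g : Hom B C) → ((f ⨾ g) †) ≈ ((g †) ⨾ (f †))
    †-invol : ∀ {A B} (f : Hom A B) → ((f †) †) ≈ f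

module _ {o m e} (X : DaggerCategory o m e) where
  open DaggerCategory X

  record IsMPInverse {A B : Obj} (f : Hom A B) (g : Hom B A) : Set e where
    field
      mp1 : (f ⨾ g ⨾ f) ≈ f
      mp2 : (g ⨾ f ⨾ g) ≈ g
      mp3 : ((f ⨾ g) †) ≈ (f ⨾ g)
      mp4 : ((g ⨾ f) †) ≈ (g ⨾ f)

  MPInvertible : {A B : Obj} → Hom A B → Set (m ⊔ e)
  MPInvertible {A} {B} f = Σ (Hom B A) (IsMPInverse f)

  IsMoorePenrose : Set (o ⊔ m ⊔ e)
  IsMoorePenrose = ∀ {A B : Obj} (f : Hom A B) → MPInvertible f

  CondII : {A B : Obj} → Hom A B → Set (m ⊔ e)
  CondII {A} {B} f = Σ (Hom B B) λ g →
    IsMPInverse ((f †) ⨾ f) g × ((f ⨾ g ⨾ (f †) ⨾ f) ≈ f)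

  CondIII : {A B : Obj} → Hom A B → Set (m ⊔ e)
  CondIII {A} {B} f = Σ (Hom A A) λ g →
    IsMPInverse (f ⨾ (f †)) g × ((f ⨾ (f †) ⨾ g ⨾ f) ≈ f)

{-# OPTIONS --safe #-}
-- If f° is the Moore-Penrose inverse of f, then f° f°† is that of f†f, since both
-- composites of f†f with it equal the projection f° f.  Conversely, if g = (f†f)°
-- and f g f† f = f, then g f† is a Moore-Penrose inverse of f.  Condition (iii) is
-- condition (ii) in the opposite dagger category.
module Submission where

open import Defs
open import Level using (Level)
open import Data.Product using (_×_; _,_)
open import Data.Sum using (_⊎_; inj₁; [_,_])
open import Function.Bundles using (_⇔_; mk⇔; module Equivalence)
open import Relation.Binary using (Setoid; IsEquivalence)
open import Function.Properties.Equivalence using () renaming (trans to ⇔-trans; sym to ⇔-sym)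
import Relation.Binary.Reasoning.Setoid as SetoidReasoning

module DaggerReasoning {o m e} (X : DaggerCategory o m e) where
  open DaggerCategory X public

  hom-setoid : Obj → Obj → Setoid m e
  hom-setoid A B = record { Carrier = Hom A B ; _≈_ = _≈_ ; isEquivalence = ≈-equiv }

  module ≈ {A B : Obj} = IsEquivalence (≈-equiv {A} {B})
  module HomReasoning {A B : Obj} = SetoidReasoning (hom-setoid A B)
  open HomReasoning public

  ⨾-congˡ : ∀ {A B C} {f : Hom A B} {g g′ : Hom B C} → g ≈ g′ → f ⨾ g ≈ f ⨾ g′
  ⨾-congˡ = ⨾-resp-≈ ≈.refl

  ⨾-congʳ : ∀ {A B C} {f f′ : Hom A B} {g : Hom B C} → f ≈ f′ → f ⨾ g ≈ f′ ⨾ g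
  ⨾-congʳ p = ⨾-resp-≈ p ≈.refl

  assoc⁻¹ : ∀ {A B C D} (f : Hom A B) (g : Hom B C) (h : Hom C D) →
            f ⨾ g ⨾ h ≈ (f ⨾ g) ⨾ h
  assoc⁻¹ f g h = ≈.sym (assoc f g h)

  SelfAdjoint : ∀ {A} → Hom A A → Set e
  SelfAdjoint f = f † ≈ f

  selfAdjoint-resp-≈ : ∀ {A} {f g : Hom A A} → f ≈ g → SelfAdjoint g → SelfAdjoint f
  selfAdjoint-resp-≈ {f = f} {g} f≈g g-selfAdjoint = begin
    f †  ≈⟨ †-resp-≈ f≈g ⟩
    g †  ≈⟨ g-selfAdjoint ⟩
    g    ≈⟨ ≈.sym f≈g ⟩
    f    ∎

  selfAdjoint-†⨾ : ∀ {A B} (f : Hom A B) → SelfAdjoint (f † ⨾ f)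
  selfAdjoint-†⨾ f = begin
    (f † ⨾ f) †    ≈⟨ †-⨾ (f †) f ⟩
    f † ⨾ f † †    ≈⟨ ⨾-congˡ (†-invol f) ⟩
    f † ⨾ f        ∎

  selfAdjoint-conjugate : ∀ {A B} (a : Hom A B) {k : Hom B B} →
                          SelfAdjoint k → SelfAdjoint (a ⨾ k ⨾ a †)
  selfAdjoint-conjugate a {k} k-selfAdjoint = begin
    (a ⨾ k ⨾ a †) †        ≈⟨ †-⨾ a (k ⨾ a †) ⟩
    (k ⨾ a †) † ⨾ a †      ≈⟨ ⨾-congʳ (†-⨾ k (a †)) ⟩
    (a † † ⨾ k †) ⨾ a †    ≈⟨ ⨾-congʳ (⨾-resp-≈ (†-invol a) k-selfAdjoint) ⟩
    (a ⨾ k) ⨾ a †          ≈⟨ assoc a k (a †) ⟩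
    a ⨾ k ⨾ a †            ∎

module MPInverseOfDaggerSquare {o m e} (X : DaggerCategory o m e) where
  open DaggerReasoning X
  open IsMPInverse

  module _ {A B} {f : Hom A B} {f° : Hom B A} (M : IsMPInverse X f f°) where

    f⨾f°⨾f≈f : (f ⨾ f°) ⨾ f ≈ f
    f⨾f°⨾f≈f = ≈.trans (assoc f f° f) (mp1 M)

    f°†⨾f†≈f⨾f° : f° † ⨾ f † ≈ f ⨾ f°
    f°†⨾f†≈f⨾f° = ≈.trans (≈.sym (†-⨾ f f°)) (mp3 M)

    f†⨾f⨾f°≈f† : f † ⨾ f ⨾ f° ≈ f †
    f†⨾f⨾f°≈f† = begin
      f † ⨾ f ⨾ f°           ≈⟨ ⨾-congˡ (≈.sym (mp3 M)) ⟩
      f † ⨾ (f ⨾ f°) †       ≈⟨ ≈.sym (†-⨾ (f ⨾ f°) f) ⟩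
      ((f ⨾ f°) ⨾ f) †       ≈⟨ †-resp-≈ f⨾f°⨾f≈f ⟩
      f †                    ∎

    f°⨾f⨾f†≈f† : f° ⨾ f ⨾ f † ≈ f †
    f°⨾f⨾f†≈f† = begin
      f° ⨾ f ⨾ f †           ≈⟨ assoc⁻¹ f° f (f †) ⟩
      (f° ⨾ f) ⨾ f †         ≈⟨ ⨾-congʳ (≈.sym (mp4 M)) ⟩
      (f° ⨾ f) † ⨾ f †       ≈⟨ ≈.sym (†-⨾ f (f° ⨾ f)) ⟩
      (f ⨾ f° ⨾ f) †         ≈⟨ †-resp-≈ (mp1 M) ⟩
      f †                    ∎

    f°f°†⨾f†f≈f°f : (f° ⨾ f° †) ⨾ f † ⨾ f ≈ f° ⨾ f
    f°f°†⨾f†f≈f°f = begin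
      (f° ⨾ f° †) ⨾ f † ⨾ f    ≈⟨ assoc f° (f° †) (f † ⨾ f) ⟩
      f° ⨾ f° † ⨾ f † ⨾ f      ≈⟨ ⨾-congˡ (assoc⁻¹ (f° †) (f †) f) ⟩
      f° ⨾ (f° † ⨾ f †) ⨾ f    ≈⟨ ⨾-congˡ (⨾-congʳ f°†⨾f†≈f⨾f°) ⟩
      f° ⨾ (f ⨾ f°) ⨾ f        ≈⟨ ⨾-congˡ f⨾f°⨾f≈f ⟩
      f° ⨾ f                   ∎

    f†f⨾f°f°†≈f°f : (f † ⨾ f) ⨾ f° ⨾ f° † ≈ f° ⨾ f
    f†f⨾f°f°†≈f°f = begin
      (f † ⨾ f) ⨾ f° ⨾ f° †    ≈⟨ assoc⁻¹ (f † ⨾ f) f° (f° †) ⟩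
      ((f † ⨾ f) ⨾ f°) ⨾ f° †  ≈⟨ ⨾-congʳ (≈.trans (assoc (f †) f f°) f†⨾f⨾f°≈f†) ⟩
      f † ⨾ f° †               ≈⟨ ≈.sym (†-⨾ f° f) ⟩
      (f° ⨾ f) †               ≈⟨ mp4 M ⟩
      f° ⨾ f                   ∎

    mpInverse-†⨾ : IsMPInverse X (f † ⨾ f) (f° ⨾ f° †)
    mpInverse-†⨾ = record
      { mp1 = begin
          (f † ⨾ f) ⨾ (f° ⨾ f° †) ⨾ f † ⨾ f   ≈⟨ ⨾-congˡ f°f°†⨾f†f≈f°f ⟩
          (f † ⨾ f) ⨾ f° ⨾ f                   ≈⟨ assoc (f †) f (f° ⨾ f) ⟩
          f † ⨾ f ⨾ f° ⨾ f                     ≈⟨ ⨾-congˡ (mp1 M) ⟩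
          f † ⨾ f                              ∎
      ; mp2 = begin
          (f° ⨾ f° †) ⨾ (f † ⨾ f) ⨾ f° ⨾ f° †  ≈⟨ assoc⁻¹ (f° ⨾ f° †) (f † ⨾ f) _ ⟩
          ((f° ⨾ f° †) ⨾ f † ⨾ f) ⨾ f° ⨾ f° †  ≈⟨ ⨾-congʳ f°f°†⨾f†f≈f°f ⟩
          (f° ⨾ f) ⨾ f° ⨾ f° †                 ≈⟨ assoc⁻¹ (f° ⨾ f) f° (f° †) ⟩
          ((f° ⨾ f) ⨾ f°) ⨾ f° †               ≈⟨ ⨾-congʳ (≈.trans (assoc f° f f°) (mp2 M)) ⟩
          f° ⨾ f° †                            ∎
      ; mp3 = selfAdjoint-resp-≈ f†f⨾f°f°†≈f°f (mp4 M)
      ; mp4 = selfAdjoint-resp-≈ f°f°†⨾f†f≈f°f (mp4 M)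
      }

    condII-of-mpInverse : CondII X f
    condII-of-mpInverse = f° ⨾ f° † , mpInverse-†⨾ , (begin
      f ⨾ (f° ⨾ f° †) ⨾ f † ⨾ f   ≈⟨ ⨾-congˡ f°f°†⨾f†f≈f°f ⟩
      f ⨾ f° ⨾ f                  ≈⟨ mp1 M ⟩
      f                           ∎)

  module _ {A B} {f : Hom A B} {g : Hom B B}
           (G : IsMPInverse X (f † ⨾ f) g) (f⨾g⨾f†⨾f≈f : f ⨾ g ⨾ f † ⨾ f ≈ f) where

    f†≈g⨾f†⨾f⨾f† : f † ≈ (g ⨾ f † ⨾ f) ⨾ f †
    f†≈g⨾f†⨾f⨾f† = begin
      f †                          ≈⟨ †-resp-≈ (≈.sym f⨾g⨾f†⨾f≈f) ⟩
      (f ⨾ g ⨾ f † ⨾ f) †          ≈⟨ †-⨾ f (g ⨾ f † ⨾ f) ⟩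
      (g ⨾ f † ⨾ f) † ⨾ f †        ≈⟨ ⨾-congʳ (mp4 G) ⟩
      (g ⨾ f † ⨾ f) ⨾ f †          ∎

    g⨾f†⨾f≈f†⨾f⨾g† : g ⨾ f † ⨾ f ≈ (f † ⨾ f) ⨾ g †
    g⨾f†⨾f≈f†⨾f⨾g† = begin
      g ⨾ f † ⨾ f                  ≈⟨ ≈.sym (mp4 G) ⟩
      (g ⨾ f † ⨾ f) †              ≈⟨ †-⨾ g (f † ⨾ f) ⟩
      (f † ⨾ f) † ⨾ g †            ≈⟨ ⨾-congʳ (selfAdjoint-†⨾ f) ⟩
      (f † ⨾ f) ⨾ g †              ∎

    -- Substituting f† ↦ (g f†f) f† exhibits f g f† as a conjugate of f†f.
    f⨾g⨾f†≈conjugate : f ⨾ g ⨾ f † ≈ (f ⨾ g) ⨾ (f † ⨾ f) ⨾ (f ⨾ g) †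
    f⨾g⨾f†≈conjugate = begin
      f ⨾ g ⨾ f †                          ≈⟨ ⨾-congˡ (⨾-congˡ f†≈g⨾f†⨾f⨾f†) ⟩
      f ⨾ g ⨾ (g ⨾ f † ⨾ f) ⨾ f †          ≈⟨ ⨾-congˡ (⨾-congˡ (⨾-congʳ g⨾f†⨾f≈f†⨾f⨾g†)) ⟩
      f ⨾ g ⨾ ((f † ⨾ f) ⨾ g †) ⨾ f †      ≈⟨ ⨾-congˡ (⨾-congˡ (assoc (f † ⨾ f) (g †) (f †))) ⟩
      f ⨾ g ⨾ (f † ⨾ f) ⨾ g † ⨾ f †        ≈⟨ assoc⁻¹ f g _ ⟩
      (f ⨾ g) ⨾ (f † ⨾ f) ⨾ g † ⨾ f †      ≈⟨ ⨾-congˡ (⨾-congˡ (≈.sym (†-⨾ f g))) ⟩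
      (f ⨾ g) ⨾ (f † ⨾ f) ⨾ (f ⨾ g) †      ∎

    mpInverse-of-condII : IsMPInverse X f (g ⨾ f †)
    mpInverse-of-condII = record
      { mp1 = ≈.trans (⨾-congˡ (assoc g (f †) f)) f⨾g⨾f†⨾f≈f
      ; mp2 = begin
          (g ⨾ f †) ⨾ f ⨾ g ⨾ f †        ≈⟨ assoc g (f †) _ ⟩
          g ⨾ f † ⨾ f ⨾ g ⨾ f †          ≈⟨ ⨾-congˡ (assoc⁻¹ (f †) f _) ⟩
          g ⨾ (f † ⨾ f) ⨾ g ⨾ f †        ≈⟨ ⨾-congˡ (assoc⁻¹ (f † ⨾ f) g (f †)) ⟩
          g ⨾ ((f † ⨾ f) ⨾ g) ⨾ f †      ≈⟨ assoc⁻¹ g _ (f †) ⟩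
          (g ⨾ (f † ⨾ f) ⨾ g) ⨾ f †      ≈⟨ ⨾-congʳ (mp2 G) ⟩
          g ⨾ f †                        ∎
      ; mp3 = selfAdjoint-resp-≈ f⨾g⨾f†≈conjugate
                (selfAdjoint-conjugate (f ⨾ g) (selfAdjoint-†⨾ f))
      ; mp4 = selfAdjoint-resp-≈ (assoc g (f †) f) (mp4 G)
      }

  mpInvertible⇔condII : ∀ {A B} (f : Hom A B) → MPInvertible X f ⇔ CondII X f
  mpInvertible⇔condII f = mk⇔
    (λ (f° , M) → condII-of-mpInverse M)
    (λ (g , G , f⨾g⨾f†⨾f≈f) → g ⨾ f † , mpInverse-of-condII G f⨾g⨾f†⨾f≈f)

op : ∀ {o m e} → DaggerCategory o m e → DaggerCategory o m e
op X = record
  { Obj = Obj ; Hom = λ A B → Hom B A ; _≈_ = _≈_ ; ≈-equiv = ≈-equiv ; id = id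
  ; _⨾_ = λ f g → g ⨾ f ; ⨾-resp-≈ = λ p q → ⨾-resp-≈ q p
  ; assoc = λ f g h → assoc⁻¹ h g f
  ; idˡ = idʳ ; idʳ = idˡ ; _† = _† ; †-resp-≈ = †-resp-≈ ; †-id = †-id
  ; †-⨾ = λ f g → †-⨾ g f ; †-invol = †-invol }
  where open DaggerReasoning X

module OppositeDuality {o m e} (X : DaggerCategory o m e) where
  open DaggerReasoning X
  open IsMPInverse

  mpInverse-op⇒ : ∀ {A B} {f : Hom A B} {g : Hom B A} →
                  IsMPInverse (op X) f g → IsMPInverse X f g
  mpInverse-op⇒ {f = f} {g} M = record
    { mp1 = ≈.trans (assoc⁻¹ f g f) (mp1 M) ; mp2 = ≈.trans (assoc⁻¹ g f g) (mp2 M)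
    ; mp3 = mp4 M ; mp4 = mp3 M }

  mpInverse-⇒op : ∀ {A B} {f : Hom A B} {g : Hom B A} →
                  IsMPInverse X f g → IsMPInverse (op X) f g
  mpInverse-⇒op {f = f} {g} M = record
    { mp1 = ≈.trans (assoc f g f) (mp1 M) ; mp2 = ≈.trans (assoc g f g) (mp2 M)
    ; mp3 = mp4 M ; mp4 = mp3 M }

  mpInvertible-op⇔ : ∀ {A B} (f : Hom A B) → MPInvertible (op X) f ⇔ MPInvertible X f
  mpInvertible-op⇔ f = mk⇔
    (λ (g , M) → g , mpInverse-op⇒ M)
    (λ (g , M) → g , mpInverse-⇒op M)

  condII-op⇔condIII : ∀ {A B} (f : Hom A B) → CondII (op X) f ⇔ CondIII X f
  condII-op⇔condIII f = mk⇔
    (λ (g , G , c) → g , mpInverse-op⇒ G ,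
       ≈.trans (assoc⁻¹ f (f †) (g ⨾ f)) (≈.trans (assoc⁻¹ (f ⨾ f †) g f) c))
    (λ (g , G , c) → g , mpInverse-⇒op G ,
       ≈.trans (assoc (f ⨾ f †) g f) (≈.trans (assoc f (f †) (g ⨾ f)) c))

  mpInvertible⇔condIII : ∀ {A B} (f : Hom A B) → MPInvertible X f ⇔ CondIII X f
  mpInvertible⇔condIII f =
    ⇔-trans (⇔-sym (mpInvertible-op⇔ f)) (⇔-trans (mpInvertible⇔condII f) (condII-op⇔condIII f))
    where open MPInverseOfDaggerSquare (op X) using (mpInvertible⇔condII)

mainTheorem8 : ∀ {o m e : Level} (X : DaggerCategory o m e) →
    (∀ {A B : DaggerCategory.Obj X} (f : DaggerCategory.Hom X A B) →
      (MPInvertible X f ⇔ CondII X f) × (MPInvertible X f ⇔ CondIII X f))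
    × (IsMoorePenrose X ⇔ (∀ {A B : DaggerCategory.Obj X} (f : DaggerCategory.Hom X A B) → CondII X f ⊎ CondIII X f))
mainTheorem8 X = (λ f → mpInvertible⇔condII f , mpInvertible⇔condIII f) , mk⇔
  (λ mp {_} {_} f → inj₁ (to (mpInvertible⇔condII f) (mp f)))
  (λ cond {_} {_} f → [ from (mpInvertible⇔condII f) , from (mpInvertible⇔condIII f) ] (cond f))
  where
  open MPInverseOfDaggerSquare X using (mpInvertible⇔condII)
  open OppositeDuality X using (mpInvertible⇔condIII)
  open Equivalence
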